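{- Let $G$ be a minimal counterexample with maximum degree $\Delta\geq 7$. If $v$ is a special vertex of type II having a $5(4)$-neighbour $u$, then $u$ is not weak-adjacent to any vertex of degree at most $5$.
   Context: All graphs are finite and simple. A 2-distance coloring of $G$ is a vertex coloring in which any two distinct vertices at distance at most $2$ receive different colors. A minimal counterexample is a planar graph $G$ with girth at least $6$ and maximum degree $\Delta=\Delta(G)\geq 6$ which admits no 2-distance coloring with $\Delta+4$ colors, and which has the minimum number of vertices among all planar graphs with girth at least $6$ and maximum degree at least $6$ admitting no 2-distance coloring with (their maximum degree)$+4$ colors. A $k$-vertex has degree $k$; a $k(d)$-vertex is a $k$-vertex adjacent to exactly $d$ vertices of degree $2$. Two vertices $u,w$ are weak-adjacent if there is a path $uxw$ with $d(x)=2$. A special vertex of type II is a $4(3)$-vertex adjacent to a vertex of degree $4$ or $5$. -}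

module Defs where

open import Data.Nat using (ℕ; zero; suc; _≤_; _<_; _+_; _⊔_)
open import Data.Nat as ℕ using (_≡ᵇ_)
open import Data.Bool using (Bool; true; false; _∧_)
open import Data.Fin using (Fin)
open import Data.List using (List; length; filter; allFin; map; foldr)
open import Data.Product using (Σ; _×_; _,_; proj₁; proj₂; ∃)
open import Data.Sum using (_⊎_)
open import Data.Rational using (ℚ; 0ℚ; 1ℚ) renaming (_+_ to _+q_; _*_ to _*q_; _-_ to _-q_; _≤_ to _≤q_)
open import Relation.Binary.PropositionalEquality using (_≡_; _≢_)
open import Relation.Nullary using (¬_)
open import Function.Definitions using (Injective)
open import Relation.Unary using (Pred)

record Graph (n : ℕ) : Set where
  field
    adj   : Fin n → Fin n → Bool
    sym   : ∀ u v → adj u v ≡ adj v u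
    irrefl : ∀ v → adj v v ≡ false
open Graph public

Adj : ∀ {n} → Graph n → Fin n → Fin n → Set
Adj G u v = adj G u v ≡ true

count : ∀ {n} → (Fin n → Bool) → ℕ
count {n} p = length (filter (λ x → Data.Bool._≟_ (p x) true) (allFin n))

deg : ∀ {n} → Graph n → Fin n → ℕ
deg G v = count (adj G v)

deg2Nbrs : ∀ {n} → Graph n → Fin n → ℕ
deg2Nbrs G v = count (λ x → adj G v x ∧ (deg G x ≡ᵇ 2))

maxDeg : ∀ {n} → Graph n → ℕ
maxDeg {n} G = foldr _⊔_ 0 (map (deg G) (allFin n))

IsCycle : ∀ {n} → Graph n → (k : ℕ) → (Fin k → Fin n) → Set
IsCycle {n} G k c =
  Injective _≡_ _≡_ c ×
  (∀ (i j : Fin k) → suc (Data.Fin.toℕ i) ≡ Data.Fin.toℕ j → Adj G (c i) (c j)) ×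
  (∀ (i j : Fin k) → suc (Data.Fin.toℕ i) ≡ k → Data.Fin.toℕ j ≡ 0 → Adj G (c i) (c j))

GirthAtLeast : ∀ {n} → Graph n → ℕ → Set
GirthAtLeast G g = ∀ k → 3 ≤ k → k < g → (c : Fin k → Fin _) → ¬ IsCycle G k c

-- Planarity: existence of a straight-line drawing with rational
-- coordinates (equivalent to planarity by Fáry's theorem).

Point : Set
Point = ℚ × ℚ

OnSeg : Point → Point → Point → Set
OnSeg p q x = Σ ℚ λ t → (0ℚ ≤q t) × (t ≤q 1ℚ) ×
  (x ≡ (proj₁ p +q t *q (proj₁ q -q proj₁ p) , proj₂ p +q t *q (proj₂ q -q proj₂ p)))

Planar : ∀ {n} → Graph n → Set
Planar {n} G = Σ (Fin n → Point) λ pos →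
  Injective _≡_ _≡_ pos ×
  (∀ a b w → Adj G a b → OnSeg (pos a) (pos b) (pos w) → (w ≡ a ⊎ w ≡ b)) ×
  (∀ a b c d x → Adj G a b → Adj G c d →
     OnSeg (pos a) (pos b) x → OnSeg (pos c) (pos d) x →
     ((a ≡ c × b ≡ d) ⊎ (a ≡ d × b ≡ c)) ⊎
     ((x ≡ pos a ⊎ x ≡ pos b) × (x ≡ pos c ⊎ x ≡ pos d)))

DistAtMost2 : ∀ {n} → Graph n → Fin n → Fin n → Set
DistAtMost2 G u v = Adj G u v ⊎ (Σ _ λ x → Adj G u x × Adj G x v)

TwoDistColoring : ∀ {n} → Graph n → (k : ℕ) → (Fin n → Fin k) → Set
TwoDistColoring G k f = ∀ u v → u ≢ v → DistAtMost2 G u v → f u ≢ f v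

TwoDistColorable : ∀ {n} → Graph n → ℕ → Set
TwoDistColorable {n} G k = Σ (Fin n → Fin k) (TwoDistColoring G k)

InClass : ∀ {n} → Graph n → Set
InClass G = Planar G × GirthAtLeast G 6 × 6 ≤ maxDeg G

MinimalCounterexample : ∀ {n} → Graph n → Set
MinimalCounterexample {n} G =
  InClass G × ¬ TwoDistColorable G (maxDeg G + 4) ×
  (∀ m → m < n → (H : Graph m) → InClass H → TwoDistColorable H (maxDeg H + 4))

IsKD : ∀ {n} → Graph n → ℕ → ℕ → Fin n → Set
IsKD G k d v = deg G v ≡ k × deg2Nbrs G v ≡ d

SpecialII : ∀ {n} → Graph n → Fin n → Set
SpecialII G v = IsKD G 4 3 v × Σ _ λ y → Adj G v y × (deg G y ≡ 4 ⊎ deg G y ≡ 5)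

WeakAdj : ∀ {n} → Graph n → Fin n → Fin n → Set
WeakAdj G u w = u ≢ w × Σ _ λ x → Adj G u x × Adj G x w × deg G x ≡ 2

{-# OPTIONS --safe #-}
module Submission where

-- Suppose d(w) ≤ 5 and let x be the 2-vertex joining u and w.  Deleting x
-- gives a smaller graph in the class (Δ drops by at most one, so it stays
-- at least 6), which has a 2-distance colouring with at most Δ + 4 colours.
-- Keep this colouring on every vertex other than u, v, x and colour u, v, x
-- greedily in that order.  All neighbours of u other than v, and all
-- neighbours of v other than u, have degree 2, and the only neighbours of x
-- are u and w; so at each step at most 10 already coloured vertices lie
-- within distance two, fewer than Δ + 4 ≥ 11.  This 2-distance colours G.

open import Defs hiding (sym)
open import Data.Bool.Base using (Bool; true; false; _∧_; not; if_then_else_)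
import Data.Bool.Properties as Bool
open import Data.Bool.Properties using (∧-zeroʳ)
open import Data.Fin.Base using (Fin; zero; suc; punchIn; punchOut; fromℕ<)
open import Data.Fin.Properties
  using (punchInᵢ≢i; punchIn-punchOut; punchIn-injective; inject≤-injective; pigeonhole; ¬∀⟶∃¬)
  renaming (_≟_ to _≟ᶠ_; <⇒≢ to <⇒≢ᶠ)
open import Data.List.Base using (List; []; _∷_; [_]; _++_; filter; allFin; tabulate; length; concat; map; lookup)
open import Data.List.Properties using (length-++; length-map; foldr-preservesᵒ; foldr-preservesᵇ)
open import Data.List.Relation.Unary.Any as Any using (here; there; index; toSum)
import Data.List.Relation.Unary.Any.Properties as Any
import Data.List.Relation.Unary.All.Properties as All
open import Data.List.Membership.Propositional using (_∈_; _∉_)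
open import Data.List.Membership.Propositional.Properties
  using (∈-filter⁺; ∈-allFin; ∈-tabulate⁺; ∈-concat⁺′; ∈-++⁺ʳ; ∈-map⁺)
import Data.List.Membership.DecPropositional as DecMembership
open import Data.Nat.Base using (ℕ; zero; suc; _+_; _*_; _⊔_; _≡ᵇ_; _≤_; _<_; z≤n; s≤s)
open import Data.Nat.Properties
  using ( _≤?_; _<?_; ≤-refl; ≤-trans; ≤-reflexive; ≤-pred; +-mono-≤; +-monoˡ-≤; +-monoʳ-≤; m≤n+m
        ; m≤n⇒m≤n⊔o; m≤n⇒m≤o⊔n; ⊔-lub; ≰⇒>; <⇒≱; ≮⇒≥; 1+n≰n; module ≤-Reasoning)
import Data.Nat.Properties as ℕ
open import Algebra.Properties.Semiring.Sum ℕ.+-*-semiring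
  using (sum-syntax; ∑-distrib-+; *-distribˡ-sum; sum-remove; sum-cong-≗; sum-replicate-zero)
open import Data.Product.Base as Product using (∃; _,_; _×_; proj₁; proj₂)
open import Data.Sum.Base as Sum using (_⊎_; inj₁; inj₂)
open import Data.Vec.Functional using (updateAt; insertAt)
open import Data.Vec.Functional.Properties using (updateAt-updates; updateAt-minimal; insertAt-punchIn)
open import Function.Base using (_∘_; const)
open import Function.Definitions using (Injective)
open import Relation.Binary.PropositionalEquality
  using (_≡_; _≢_; refl; sym; trans; cong; cong₂; subst; module ≡-Reasoning)
open import Relation.Nullary.Decidable using (does; yes; no; dec-true; dec-false)
open import Relation.Nullary.Negation using (¬_; contradiction)

open module FinMembership {n} = DecMembership (_≟ᶠ_ {n}) using (_∈?_)

⟦_⟧ : Bool → ℕ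
⟦ b ⟧ = if b then 1 else 0

⟦⟧≤1 : ∀ b → ⟦ b ⟧ ≤ 1
⟦⟧≤1 true  = ≤-refl
⟦⟧≤1 false = z≤n

⟦⟧-mono : ∀ {a b} → (a ≡ true → b ≡ true) → ⟦ a ⟧ ≤ ⟦ b ⟧
⟦⟧-mono {false} _   = z≤n
⟦⟧-mono {true}  a⇒b rewrite a⇒b refl = ≤-refl

δ : ∀ {n} → Fin n → Fin n → ℕ
δ a i = ⟦ does (a ≟ᶠ i) ⟧

∑-mono-≤ : ∀ {n} {f g : Fin n → ℕ} → (∀ i → f i ≤ g i) → ∑[ i < n ] f i ≤ ∑[ i < n ] g i
∑-mono-≤ {zero}  f≤g = z≤n
∑-mono-≤ {suc n} f≤g = +-mono-≤ (f≤g zero) (∑-mono-≤ (f≤g ∘ suc))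

∑-* : ∀ {n} k (f : Fin n → ℕ) → ∑[ i < n ] (k * f i) ≡ k * ∑[ i < n ] f i
∑-* k f = sym (*-distribˡ-sum k f)

∑-δ : ∀ {n} (a : Fin n) → ∑[ i < n ] δ a i ≡ 1
∑-δ {suc n} a = begin
  ∑[ i < suc n ] δ a i                        ≡⟨ sum-remove {i = a} (δ a) ⟩
  δ a a + ∑[ j < n ] δ a (punchIn a j)         ≡⟨ cong₂ _+_ (cong ⟦_⟧ (dec-true (a ≟ᶠ a) refl))
                                                    (sum-cong-≗ (cong ⟦_⟧ ∘ dec-false (a ≟ᶠ _) ∘ (_∘ sym) ∘ punchInᵢ≢i a)) ⟩
  1 + ∑[ j < n ] 0                            ≡⟨ cong suc (sum-replicate-zero n) ⟩
  1                                           ∎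
  where open ≡-Reasoning

length-concat-tabulate : ∀ {A : Set} {n} (f : Fin n → List A) →
                         length (concat (tabulate f)) ≡ ∑[ i < n ] length (f i)
length-concat-tabulate {n = zero}  f = refl
length-concat-tabulate {n = suc n} f =
  trans (length-++ (f zero)) (cong (length (f zero) +_) (length-concat-tabulate (f ∘ suc)))

-- count p ≡ length (vertices p) holds by definition.
vertices : ∀ {n} → (Fin n → Bool) → List (Fin n)
vertices {n} p = filter (λ y → p y Bool.≟ true) (allFin n)

∈-vertices⁺ : ∀ {n} {p : Fin n → Bool} {y} → p y ≡ true → y ∈ vertices p
∈-vertices⁺ {y = y} py = ∈-filter⁺ (λ z → _ Bool.≟ true) (∈-allFin y) py

count≡∑ : ∀ {n} (p : Fin n → Bool) → count p ≡ ∑[ i < n ] ⟦ p i ⟧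
count≡∑ {n} p = count-tabulate (λ i → i)
  where
  count-tabulate : ∀ {k} (f : Fin k → Fin n) →
                   length (filter (λ y → p y Bool.≟ true) (tabulate f)) ≡ ∑[ i < k ] ⟦ p (f i) ⟧
  count-tabulate {zero}  f = refl
  count-tabulate {suc k} f with p (f zero)
  ... | true  = cong suc (count-tabulate (f ∘ suc))
  ... | false = count-tabulate (f ∘ suc)

_⊆ᵇ_ : ∀ {n} → (Fin n → Bool) → (Fin n → Bool) → Set
q ⊆ᵇ p = ∀ y → q y ≡ true → p y ≡ true

count-< : ∀ {n} {p q : Fin n → Bool} {a} → q ⊆ᵇ p → p a ≡ true → q a ≡ false → count q < count p
count-< {suc n} {p} {q} {a} q⊆p pa qa
  rewrite count≡∑ p | count≡∑ q | sum-remove {i = a} (⟦_⟧ ∘ p) | sum-remove {i = a} (⟦_⟧ ∘ q) | pa | qa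
  = s≤s (∑-mono-≤ (λ j → ⟦⟧-mono (q⊆p (punchIn a j))))

count-pos : ∀ {n} {p : Fin n → Bool} {a} → p a ≡ true → 0 < count p
count-pos {p = p} pa = ≤-trans (s≤s z≤n) (count-< {p = p} {q = λ _ → false} (λ _ ()) pa refl)

count-<₂ : ∀ {n} {p q : Fin n → Bool} {a b} → q ⊆ᵇ p → p a ≡ true → p b ≡ true → a ≢ b →
           q a ≡ false → q b ≡ false → 2 + count q ≤ count p
count-<₂ {p = p} {q} {a} {b} q⊆p pa pb a≢b qa qb =
  ≤-trans (s≤s (count-< q⊆p∖a p∖a-b qb)) (count-< p∖a⊆p pa p∖a-a)
  where
  p∖a : _ → Bool
  p∖a y = p y ∧ not (does (y ≟ᶠ a))
  p∖a⊆p : p∖a ⊆ᵇ p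
  p∖a⊆p y p∖a-y with p y
  ... | true = refl
  q⊆p∖a : q ⊆ᵇ p∖a
  q⊆p∖a y qy rewrite q⊆p y qy | dec-false (y ≟ᶠ a) (λ { refl → contradiction (trans (sym qy) qa) λ () }) = refl
  p∖a-a : p∖a a ≡ false
  p∖a-a rewrite pa | dec-true (a ≟ᶠ a) refl = refl
  p∖a-b : p∖a b ≡ true
  p∖a-b rewrite pb | dec-false (b ≟ᶠ a) (a≢b ∘ sym) = refl

free-colour : ∀ {k} (cs : List (Fin k)) → length cs < k → ∃ λ c → c ∉ cs
free-colour {k} cs len<k = ¬∀⟶∃¬ k (_∈ cs) (_∈? cs) not-all-used
  where
  not-all-used : ¬ (∀ c → c ∈ cs)
  not-all-used c∈cs with pigeonhole len<k (λ c → index (c∈cs c))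
  ... | i , j , i<j , same-index = <⇒≢ᶠ i<j (begin
    i                               ≡⟨ Any.lookup-index (c∈cs i) ⟩
    lookup cs (index (c∈cs i))      ≡⟨ cong (lookup cs) same-index ⟩
    lookup cs (index (c∈cs j))      ≡⟨ Any.lookup-index (c∈cs j) ⟨
    j                               ∎)
    where open ≡-Reasoning

module _ {n} (G : Graph n) where

  Adj-sym : ∀ {a b} → Adj G a b → Adj G b a
  Adj-sym {a} {b} ab = trans (Graph.sym G b a) ab

  DistAtMost2-sym : ∀ {a b} → DistAtMost2 G a b → DistAtMost2 G b a
  DistAtMost2-sym (inj₁ ab)            = inj₁ (Adj-sym ab)
  DistAtMost2-sym (inj₂ (z , az , zb)) = inj₂ (z , Adj-sym zb , Adj-sym az)

  deg≤maxDeg : ∀ v → deg G v ≤ maxDeg G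
  deg≤maxDeg v = foldr-preservesᵒ {P = deg G v ≤_} {f = _⊔_}
    (λ a b → Sum.[ m≤n⇒m≤n⊔o b , m≤n⇒m≤o⊔n a ])
    0 (map (deg G) (allFin n)) (inj₂ (Any.map⁺ (Any.map (λ { refl → ≤-refl }) (∈-allFin v))))

  maxDeg≤ : ∀ {k} → (∀ v → deg G v ≤ k) → maxDeg G ≤ k
  maxDeg≤ {k} deg≤k = foldr-preservesᵇ {P = _≤ k} {f = _⊔_} ⊔-lub z≤n (All.map⁺ (All.tabulate⁺ deg≤k))

  maxDeg-attained : ∀ {k} → k < maxDeg G → ∃ λ v → k < deg G v
  maxDeg-attained {k} k<Δ = Product.map₂ ≰⇒>
    (¬∀⟶∃¬ n (λ v → deg G v ≤ k) (λ v → deg G v ≤? k) (λ deg≤k → <⇒≱ k<Δ (maxDeg≤ deg≤k)))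

  IsKD-other-nbrs-deg2 : ∀ {d t s z} → IsKD G (suc d) d t → Adj G t s → deg G s ≢ 2 →
                         Adj G t z → z ≢ s → deg G z ≡ 2
  IsKD-other-nbrs-deg2 {d} {t} {s} {z} (deg-t , deg2Nbrs-t) ts s≢2 tz z≢s with deg G z ℕ.≟ 2
  ... | yes z≡2 = z≡2
  ... | no  z≢2 = contradiction (begin
    2 + d                  ≡⟨ cong (2 +_) deg2Nbrs-t ⟨
    2 + deg2Nbrs G t       ≤⟨ count-<₂ deg2⊆adj ts tz (z≢s ∘ sym) (not-deg2 ts s≢2) (not-deg2 tz z≢2) ⟩
    deg G t                ≡⟨ deg-t ⟩
    suc d                  ∎) 1+n≰n
    where
    open ≤-Reasoning
    deg2⊆adj : (λ y → adj G t y ∧ (deg G y ≡ᵇ 2)) ⊆ᵇ adj G t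
    deg2⊆adj y ty∧deg2 with adj G t y
    ... | true = refl
    not-deg2 : ∀ {y} → Adj G t y → deg G y ≢ 2 → (adj G t y ∧ (deg G y ≡ᵇ 2)) ≡ false
    not-deg2 {y} ty y≢2 rewrite ty = dec-false (deg G y ℕ.≟ 2) y≢2

  nbrs-of-deg2 : ∀ {t a b z} → deg G t ≡ 2 → Adj G t a → Adj G t b → a ≢ b → Adj G t z → z ≡ a ⊎ z ≡ b
  nbrs-of-deg2 {t} {a} {b} {z} deg-t ta tb a≢b tz with z ≟ᶠ a | z ≟ᶠ b
  ... | yes z≡a | _       = inj₁ z≡a
  ... | no _    | yes z≡b = inj₂ z≡b
  ... | no z≢a  | no z≢b  = contradiction (begin
    3                    ≤⟨ +-monoʳ-≤ 2 (count-pos {p = is-z} z-is-z) ⟩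
    2 + count is-z       ≤⟨ count-<₂ is-z⊆adj ta tb a≢b (not-z z≢a) (not-z z≢b) ⟩
    deg G t              ≡⟨ deg-t ⟩
    2                    ∎) 1+n≰n
    where
    open ≤-Reasoning
    is-z : Fin n → Bool
    is-z y = adj G t y ∧ does (y ≟ᶠ z)
    is-z⊆adj : is-z ⊆ᵇ adj G t
    is-z⊆adj y ty∧y≡z with adj G t y
    ... | true = refl
    z-is-z : is-z z ≡ true
    z-is-z rewrite tz | dec-true (z ≟ᶠ z) refl = refl
    not-z : ∀ {y} → z ≢ y → is-z y ≡ false
    not-z {y} z≢y rewrite dec-false (y ≟ᶠ z) (z≢y ∘ sym) = ∧-zeroʳ (adj G t y)

-- Vertex deletion

induced : ∀ {m n} → Graph n → (Fin m → Fin n) → Graph m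
induced G ι = record
  { adj    = λ i j → adj G (ι i) (ι j)
  ; sym    = λ i j → Graph.sym G (ι i) (ι j)
  ; irrefl = λ i → Graph.irrefl G (ι i)
  }

_∖_ : ∀ {m} → Graph (suc m) → Fin (suc m) → Graph m
G ∖ x = induced G (punchIn x)

module _ {m n} {G : Graph n} {ι : Fin m → Fin n} (ι-injective : Injective _≡_ _≡_ ι) where

  Planar-induced : Planar G → Planar (induced G ι)
  Planar-induced (pos , pos-injective , vertex-off-edges , edges-meet-at-ends) =
    pos ∘ ι , ι-injective ∘ pos-injective ,
    (λ a b w ab on → Sum.map ι-injective ι-injective (vertex-off-edges (ι a) (ι b) (ι w) ab on)) ,
    (λ a b c d p ab cd on₁ on₂ → Sum.map₁
      (Sum.map (Product.map ι-injective ι-injective) (Product.map ι-injective ι-injective))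
      (edges-meet-at-ends (ι a) (ι b) (ι c) (ι d) p ab cd on₁ on₂))

  GirthAtLeast-induced : ∀ {g} → GirthAtLeast G g → GirthAtLeast (induced G ι) g
  GirthAtLeast-induced girth k 3≤k k<g c (c-injective , steps , closing) =
    girth k 3≤k k<g (ι ∘ c) (c-injective ∘ ι-injective , steps , closing)

punchIn-onto : ∀ {m} {x y : Fin (suc m)} → x ≢ y → ∃ λ i → punchIn x i ≡ y
punchIn-onto x≢y = punchOut x≢y , punchIn-punchOut x≢y

module _ {m} (G : Graph (suc m)) (x : Fin (suc m)) where

  deg-punchIn : ∀ i → deg G (punchIn x i) ≡ ⟦ adj G (punchIn x i) x ⟧ + deg (G ∖ x) i
  deg-punchIn i = begin
    deg G (punchIn x i)                                          ≡⟨ count≡∑ (adj G (punchIn x i)) ⟩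
    ∑[ y < suc m ] ⟦ adj G (punchIn x i) y ⟧                      ≡⟨ sum-remove {i = x} (⟦_⟧ ∘ adj G (punchIn x i)) ⟩
    ⟦ adj G (punchIn x i) x ⟧ + ∑[ j < m ] ⟦ adj (G ∖ x) i j ⟧    ≡⟨ cong (⟦ adj G (punchIn x i) x ⟧ +_) (count≡∑ (adj (G ∖ x) i)) ⟨
    ⟦ adj G (punchIn x i) x ⟧ + deg (G ∖ x) i                    ∎
    where open ≡-Reasoning

  maxDeg-∖ : maxDeg (G ∖ x) ≤ maxDeg G
  maxDeg-∖ = maxDeg≤ (G ∖ x) λ i → begin
    deg (G ∖ x) i                               ≤⟨ m≤n+m _ _ ⟩
    ⟦ adj G (punchIn x i) x ⟧ + deg (G ∖ x) i   ≡⟨ deg-punchIn i ⟨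
    deg G (punchIn x i)                         ≤⟨ deg≤maxDeg G _ ⟩
    maxDeg G                                    ∎
    where open ≤-Reasoning

  ≤-maxDeg-∖ : ∀ {k} → k < maxDeg G → deg G x ≤ k → k ≤ maxDeg (G ∖ x)
  ≤-maxDeg-∖ {k} k<Δ deg-x≤k with maxDeg-attained G k<Δ
  ... | v , k<deg-v with x ≟ᶠ v
  ... | yes refl = contradiction deg-x≤k (<⇒≱ k<deg-v)
  ... | no x≢v with punchIn-onto x≢v
  ... | i , refl = ≤-trans (≤-pred (begin-strict
    k                                           <⟨ k<deg-v ⟩
    deg G (punchIn x i)                         ≡⟨ deg-punchIn i ⟩
    ⟦ adj G (punchIn x i) x ⟧ + deg (G ∖ x) i   ≤⟨ +-monoˡ-≤ _ (⟦⟧≤1 _) ⟩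
    suc (deg (G ∖ x) i)                         ∎)) (deg≤maxDeg (G ∖ x) i)
    where open ≤-Reasoning

  InClass-∖ : InClass G → 6 < maxDeg G → deg G x ≤ 6 → InClass (G ∖ x)
  InClass-∖ (planar , girth , _) 6<Δ deg-x≤6 =
    Planar-induced {G = G} (punchIn-injective x _ _) planar ,
    GirthAtLeast-induced {G = G} (punchIn-injective x _ _) girth ,
    ≤-maxDeg-∖ 6<Δ deg-x≤6

-- Partial colourings and greedy recolouring

TwoDistColoringExcept : ∀ {n} → Graph n → (k : ℕ) → List (Fin n) → (Fin n → Fin k) → Set
TwoDistColoringExcept G k S col = ∀ a b → a ≢ b → DistAtMost2 G a b → a ∉ S → b ∉ S → col a ≢ col b

∈-∉⇒≢ : ∀ {A : Set} {S : List A} {x y} → x ∈ S → y ∉ S → x ≢ y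
∈-∉⇒≢ x∈S y∉S refl = y∉S x∈S

TwoDistColoring-injective-∘ : ∀ {n k l} {G : Graph n} {col : Fin n → Fin k} {f : Fin k → Fin l} →
                              Injective _≡_ _≡_ f → TwoDistColoring G k col → TwoDistColoring G l (f ∘ col)
TwoDistColoring-injective-∘ f-injective proper a b a≢b ab = proper a b a≢b ab ∘ f-injective

module _ {m} {G : Graph (suc m)} {x : Fin (suc m)} where

  DistAtMost2-∖ : ∀ {a b} → ¬ (Adj G (punchIn x a) x × Adj G x (punchIn x b)) →
                  DistAtMost2 G (punchIn x a) (punchIn x b) → DistAtMost2 (G ∖ x) a b
  DistAtMost2-∖ _         (inj₁ ab)            = inj₁ ab
  DistAtMost2-∖ not-via-x (inj₂ (z , az , zb)) with x ≟ᶠ z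
  ... | yes refl = contradiction (az , zb) not-via-x
  ... | no x≢z with punchIn-onto x≢z
  ... | j , refl = inj₂ (j , az , zb)

  insertAt-TwoDistColoringExcept : ∀ {k S} {col : Fin m → Fin k} → TwoDistColoring (G ∖ x) k col → x ∈ S →
    (∀ {a b} → Adj G a x → Adj G x b → a ∉ S → b ∉ S → a ≡ b) →
    ∀ c → TwoDistColoringExcept G k S (insertAt col x c)
  insertAt-TwoDistColoringExcept {col = col} proper x∈S unique-via-x c a b a≢b ab a∉S b∉S
    with punchIn-onto (∈-∉⇒≢ x∈S a∉S) | punchIn-onto (∈-∉⇒≢ x∈S b∉S)
  ... | i , refl | j , refl =
    proper i j (a≢b ∘ cong (punchIn x)) (DistAtMost2-∖ (λ (ax , xb) → a≢b (unique-via-x ax xb a∉S b∉S)) ab)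
    ∘ λ same → trans (sym (insertAt-punchIn col x c i)) (trans same (insertAt-punchIn col x c j))

outside : ∀ {n} → List (Fin n) → Fin n → Bool
outside S y = not (does (y ∈? S))

outside-∉ : ∀ {n} {S : List (Fin n)} {y} → y ∉ S → outside S y ≡ true
outside-∉ {S = S} {y} y∉S rewrite dec-false (y ∈? S) y∉S = refl

outside-∈ : ∀ {n} {S : List (Fin n)} {y} → y ∈ S → outside S y ≡ false
outside-∈ {S = S} {y} y∈S rewrite dec-true (y ∈? S) y∈S = refl

module _ {n} (G : Graph n) (S : List (Fin n)) where

  nbrsOutside : Fin n → Fin n → Bool
  nbrsOutside z y = adj G z y ∧ outside S y

  closedNbrsOutside : Fin n → List (Fin n)
  closedNbrsOutside z = (if outside S z then [ z ] else []) ++ vertices (nbrsOutside z)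

  nearThrough : Fin n → Fin n → List (Fin n)
  nearThrough t z = if adj G t z then closedNbrsOutside z else []

  -- The vertices outside S within distance two of t, listed once for each neighbour of t they are reached through.
  near : Fin n → List (Fin n)
  near t = concat (tabulate (nearThrough t))

  length-near : ∀ t → length (near t) ≡ ∑[ z < n ] length (nearThrough t z)
  length-near t = length-concat-tabulate (nearThrough t)

  length-closedNbrsOutside : ∀ z → length (closedNbrsOutside z) ≡ ⟦ outside S z ⟧ + count (nbrsOutside z)
  length-closedNbrsOutside z with outside S z
  ... | true  = refl
  ... | false = refl

  length-closedNbrsOutside-≤ : ∀ z → length (closedNbrsOutside z) ≤ suc (count (nbrsOutside z))
  length-closedNbrsOutside-≤ z = ≤-trans (≤-reflexive (length-closedNbrsOutside z)) (+-monoˡ-≤ _ (⟦⟧≤1 (outside S z)))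

  length-closedNbrsOutside-∈ : ∀ {z} → z ∈ S → length (closedNbrsOutside z) ≡ count (nbrsOutside z)
  length-closedNbrsOutside-∈ {z} z∈S =
    trans (length-closedNbrsOutside z) (cong (λ b → ⟦ b ⟧ + count (nbrsOutside z)) (outside-∈ z∈S))

  nbrsOutside⊆adj : ∀ z → nbrsOutside z ⊆ᵇ adj G z
  nbrsOutside⊆adj z y zy∧out with adj G z y
  ... | true = refl

  nbrsOutside-∈ : ∀ {z a} → Adj G z a → a ∈ S → nbrsOutside z a ≡ false
  nbrsOutside-∈ za a∈S rewrite za | outside-∈ a∈S = refl

  count-nbrsOutside-< : ∀ {z a} → Adj G z a → a ∈ S → count (nbrsOutside z) < deg G z
  count-nbrsOutside-< {z} za a∈S = count-< (nbrsOutside⊆adj z) za (nbrsOutside-∈ za a∈S)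

  count-nbrsOutside-<₂ : ∀ {z a b} → Adj G z a → Adj G z b → a ≢ b → a ∈ S → b ∈ S →
                         2 + count (nbrsOutside z) ≤ deg G z
  count-nbrsOutside-<₂ {z} za zb a≢b a∈S b∈S =
    count-<₂ (nbrsOutside⊆adj z) za zb a≢b (nbrsOutside-∈ za a∈S) (nbrsOutside-∈ zb b∈S)

  ∈-closedNbrsOutside-self : ∀ {z} → z ∉ S → z ∈ closedNbrsOutside z
  ∈-closedNbrsOutside-self z∉S rewrite outside-∉ z∉S = here refl

  ∈-closedNbrsOutside-nbr : ∀ {z y} → Adj G z y → y ∉ S → y ∈ closedNbrsOutside z
  ∈-closedNbrsOutside-nbr {z} {y} zy y∉S = ∈-++⁺ʳ (if outside S z then [ z ] else [])
    (∈-vertices⁺ (subst (λ b → b ∧ outside S y ≡ true) (sym zy) (outside-∉ y∉S)))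

  ∈-near⁺ : ∀ {t z y} → Adj G t z → y ∈ closedNbrsOutside z → y ∈ near t
  ∈-near⁺ {t} {z} {y} tz y∈ =
    ∈-concat⁺′ (subst (λ b → y ∈ (if b then closedNbrsOutside z else [])) (sym tz) y∈) (∈-tabulate⁺ z)

  DistAtMost2⇒∈-near : ∀ {t y} → DistAtMost2 G t y → y ∉ S → y ∈ near t
  DistAtMost2⇒∈-near (inj₁ ty)            y∉S = ∈-near⁺ ty (∈-closedNbrsOutside-self y∉S)
  DistAtMost2⇒∈-near (inj₂ (z , tz , zy)) y∉S = ∈-near⁺ tz (∈-closedNbrsOutside-nbr zy y∉S)

recolour : ∀ {n k} {G : Graph n} {t S col} → TwoDistColoringExcept G k (t ∷ S) col →
           length (near G (t ∷ S) t) < k →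
           ∃ λ c → TwoDistColoringExcept G k S (updateAt col t (const c))
recolour {n} {k} {G} {t} {S} {col} proper len<k
  with free-colour (map col (near G (t ∷ S) t)) (subst (_< k) (sym (length-map col (near G (t ∷ S) t))) len<k)
... | c , c-unused = c , proper′
  where
  col′ : Fin n → Fin k
  col′ = updateAt col t (const c)
  ∉-∷ : ∀ {y} → y ≢ t → y ∉ S → y ∉ t ∷ S
  ∉-∷ y≢t y∉S = Sum.[ y≢t , y∉S ] ∘ toSum
  fresh : ∀ {b} → b ≢ t → b ∉ S → DistAtMost2 G t b → col′ t ≢ col′ b
  fresh {b} b≢t b∉S tb same = c-unused (subst (_∈ map col (near G (t ∷ S) t))
    (trans (sym (updateAt-minimal b t col b≢t)) (trans (sym same) (updateAt-updates t col)))
    (∈-map⁺ col (DistAtMost2⇒∈-near G (t ∷ S) tb (∉-∷ b≢t b∉S))))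
  proper′ : TwoDistColoringExcept G k S col′
  proper′ a b a≢b ab a∉S b∉S with a ≟ᶠ t | b ≟ᶠ t
  ... | yes refl | _        = fresh (a≢b ∘ sym) b∉S ab
  ... | no a≢t   | yes refl = fresh a≢b a∉S (DistAtMost2-sym G ab) ∘ sym
  ... | no a≢t   | no b≢t   = proper a b a≢b ab (∉-∷ a≢t a∉S) (∉-∷ b≢t b∉S)
    ∘ λ same → trans (sym (updateAt-minimal a t col a≢t)) (trans same (updateAt-minimal b t col b≢t))

module Configuration {m} (G : Graph (suc m)) {u v x w : Fin (suc m)}
  (v-4-3 : IsKD G 4 3 v) (u-5-4 : IsKD G 5 4 u) (vu : Adj G v u)
  (ux : Adj G u x) (xw : Adj G x w) (deg-x : deg G x ≡ 2) (u≢w : u ≢ w) (deg-w≤5 : deg G w ≤ 5) where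

  private
    n = suc m

  uv : Adj G u v
  uv = Adj-sym G vu

  xu : Adj G x u
  xu = Adj-sym G ux

  v≢x : v ≢ x
  v≢x refl = contradiction (trans (sym (proj₁ v-4-3)) deg-x) λ ()

  u-nbr-deg2 : ∀ {z} → Adj G u z → z ≢ v → deg G z ≡ 2
  u-nbr-deg2 = IsKD-other-nbrs-deg2 G u-5-4 uv (λ v≡2 → contradiction (trans (sym (proj₁ v-4-3)) v≡2) λ ())

  v-nbr-deg2 : ∀ {z} → Adj G v z → z ≢ u → deg G z ≡ 2
  v-nbr-deg2 = IsKD-other-nbrs-deg2 G v-4-3 vu (λ u≡2 → contradiction (trans (sym (proj₁ u-5-4)) u≡2) λ ())

  x-nbrs : ∀ {z} → Adj G x z → z ≡ u ⊎ z ≡ w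
  x-nbrs = nbrs-of-deg2 G deg-x xu xw u≢w

  S₀ S₁ S₂ : List (Fin n)
  S₀ = u ∷ v ∷ x ∷ []
  S₁ = v ∷ x ∷ []
  S₂ = x ∷ []

  closed-v-S₀ : length (closedNbrsOutside G S₀ v) ≤ 3
  closed-v-S₀ rewrite length-closedNbrsOutside-∈ G S₀ {v} (there (here refl)) =
    ≤-pred (≤-trans (count-nbrsOutside-< G S₀ vu (here refl)) (≤-reflexive (proj₁ v-4-3)))

  closed-x-S₀ : length (closedNbrsOutside G S₀ x) ≤ 1
  closed-x-S₀ rewrite length-closedNbrsOutside-∈ G S₀ {x} (there (there (here refl))) =
    ≤-pred (≤-trans (count-nbrsOutside-< G S₀ xu (here refl)) (≤-reflexive deg-x))

  closed-u-nbr-S₀ : ∀ {z} → Adj G u z → z ≢ v → length (closedNbrsOutside G S₀ z) ≤ 2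
  closed-u-nbr-S₀ {z} uz z≢v = ≤-trans (length-closedNbrsOutside-≤ G S₀ z)
    (≤-trans (count-nbrsOutside-< G S₀ (Adj-sym G uz) (here refl)) (≤-reflexive (u-nbr-deg2 uz z≢v)))

  -- Through v lie 3 vertices and through x only 1; the δ terms let them share the bound 2 per neighbour.
  nearThrough-u : ∀ z → δ x z + length (nearThrough G S₀ u z) ≤ 2 * ⟦ adj G u z ⟧ + δ v z
  nearThrough-u z with adj G u z in uz
  ... | false rewrite dec-false (x ≟ᶠ z) (λ { refl → contradiction (trans (sym ux) uz) λ () }) = z≤n
  ... | true with v ≟ᶠ z | x ≟ᶠ z
  ... | yes v≡z  | yes x≡z  = contradiction (trans v≡z (sym x≡z)) v≢x
  ... | yes refl | no _     = closed-v-S₀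
  ... | no _     | yes refl = s≤s closed-x-S₀
  ... | no v≢z   | no _     = closed-u-nbr-S₀ uz (v≢z ∘ sym)

  near-u : length (near G S₀ u) < 11
  near-u = begin-strict
    length (near G S₀ u)                              ≡⟨ length-near G S₀ u ⟩
    ∑[ z < n ] through z                              <⟨ ≤-refl ⟩
    1 + ∑[ z < n ] through z                          ≡⟨ cong (_+ ∑[ z < n ] through z) (∑-δ x) ⟨
    ∑[ z < n ] δ x z + ∑[ z < n ] through z           ≡⟨ ∑-distrib-+ (δ x) through ⟨
    ∑[ z < n ] (δ x z + through z)                    ≤⟨ ∑-mono-≤ nearThrough-u ⟩
    ∑[ z < n ] (2 * ⟦ adj G u z ⟧ + δ v z)            ≡⟨ ∑-distrib-+ (λ z → 2 * ⟦ adj G u z ⟧) (δ v) ⟩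
    ∑[ z < n ] (2 * ⟦ adj G u z ⟧) + ∑[ z < n ] δ v z ≡⟨ cong₂ _+_ (∑-* 2 (⟦_⟧ ∘ adj G u)) (∑-δ v) ⟩
    2 * ∑[ z < n ] ⟦ adj G u z ⟧ + 1                  ≡⟨ cong (λ d → 2 * d + 1) (count≡∑ (adj G u)) ⟨
    2 * deg G u + 1                                   ≡⟨ cong (λ d → 2 * d + 1) (proj₁ u-5-4) ⟩
    11                                                ∎
    where
    open ≤-Reasoning
    through : Fin n → ℕ
    through = length ∘ nearThrough G S₀ u

  closed-u-S₁ : length (closedNbrsOutside G S₁ u) ≤ 4
  closed-u-S₁ = ≤-trans (length-closedNbrsOutside-≤ G S₁ u)
    (≤-pred (≤-trans (count-nbrsOutside-<₂ G S₁ uv ux v≢x (here refl) (there (here refl))) (≤-reflexive (proj₁ u-5-4))))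

  closed-v-nbr-S₁ : ∀ {z} → Adj G v z → z ≢ u → length (closedNbrsOutside G S₁ z) ≤ 2
  closed-v-nbr-S₁ {z} vz z≢u = ≤-trans (length-closedNbrsOutside-≤ G S₁ z)
    (≤-trans (count-nbrsOutside-< G S₁ (Adj-sym G vz) (here refl)) (≤-reflexive (v-nbr-deg2 vz z≢u)))

  nearThrough-v : ∀ z → length (nearThrough G S₁ v z) ≤ 2 * ⟦ adj G v z ⟧ + 2 * δ u z
  nearThrough-v z with adj G v z in vz
  ... | false = z≤n
  ... | true with u ≟ᶠ z
  ... | yes refl = closed-u-S₁
  ... | no u≢z   = closed-v-nbr-S₁ vz (u≢z ∘ sym)

  near-v : length (near G S₁ v) < 11
  near-v = begin-strict
    length (near G S₁ v)                                    ≡⟨ length-near G S₁ v ⟩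
    ∑[ z < n ] length (nearThrough G S₁ v z)                ≤⟨ ∑-mono-≤ nearThrough-v ⟩
    ∑[ z < n ] (2 * ⟦ adj G v z ⟧ + 2 * δ u z)              ≡⟨ ∑-distrib-+ (λ z → 2 * ⟦ adj G v z ⟧) (λ z → 2 * δ u z) ⟩
    ∑[ z < n ] (2 * ⟦ adj G v z ⟧) + ∑[ z < n ] (2 * δ u z) ≡⟨ cong₂ _+_ (∑-* 2 (⟦_⟧ ∘ adj G v)) (∑-* 2 (δ u)) ⟩
    2 * ∑[ z < n ] ⟦ adj G v z ⟧ + 2 * ∑[ z < n ] δ u z     ≡⟨ cong₂ (λ d e → 2 * d + 2 * e) (sym (count≡∑ (adj G v))) (∑-δ u) ⟩
    2 * deg G v + 2 * 1                                     ≡⟨ cong (λ d → 2 * d + 2) (proj₁ v-4-3) ⟩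
    10                                                      <⟨ ≤-refl ⟩
    11                                                      ∎
    where open ≤-Reasoning

  closed-x-nbr-S₂ : ∀ {z} → Adj G x z → length (closedNbrsOutside G S₂ z) ≤ 5
  closed-x-nbr-S₂ {z} xz = ≤-trans (length-closedNbrsOutside-≤ G S₂ z)
    (≤-trans (count-nbrsOutside-< G S₂ (Adj-sym G xz) (here refl)) (deg≤5 (x-nbrs xz)))
    where
    deg≤5 : z ≡ u ⊎ z ≡ w → deg G z ≤ 5
    deg≤5 (inj₁ refl) = ≤-reflexive (proj₁ u-5-4)
    deg≤5 (inj₂ refl) = deg-w≤5

  nearThrough-x : ∀ z → length (nearThrough G S₂ x z) ≤ 5 * ⟦ adj G x z ⟧
  nearThrough-x z with adj G x z in xz
  ... | false = z≤n
  ... | true  = closed-x-nbr-S₂ xz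

  near-x : length (near G S₂ x) < 11
  near-x = begin-strict
    length (near G S₂ x)                       ≡⟨ length-near G S₂ x ⟩
    ∑[ z < n ] length (nearThrough G S₂ x z)   ≤⟨ ∑-mono-≤ nearThrough-x ⟩
    ∑[ z < n ] (5 * ⟦ adj G x z ⟧)             ≡⟨ ∑-* 5 (⟦_⟧ ∘ adj G x) ⟩
    5 * ∑[ z < n ] ⟦ adj G x z ⟧               ≡⟨ cong (5 *_) (count≡∑ (adj G x)) ⟨
    5 * deg G x                                ≡⟨ cong (5 *_) deg-x ⟩
    10                                         <⟨ ≤-refl ⟩
    11                                         ∎
    where open ≤-Reasoning

  unique-via-x : ∀ {a b} → Adj G a x → Adj G x b → a ∉ S₀ → b ∉ S₀ → a ≡ b
  unique-via-x ax xb a∉S₀ b∉S₀ = trans (is-w (x-nbrs (Adj-sym G ax)) a∉S₀) (sym (is-w (x-nbrs xb) b∉S₀))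
    where
    is-w : ∀ {z} → z ≡ u ⊎ z ≡ w → z ∉ S₀ → z ≡ w
    is-w (inj₁ z≡u) z∉S₀ = contradiction (here z≡u) z∉S₀
    is-w (inj₂ z≡w) _    = z≡w

  colourable : ∀ {k} {col : Fin m → Fin k} → 11 ≤ k → TwoDistColoring (G ∖ x) k col → TwoDistColorable G k
  colourable {k} {col} 11≤k proper-∖ =
    let _ , proper₁ = recolour {G = G} proper₀ (≤-trans near-u 11≤k)
        _ , proper₂ = recolour {G = G} proper₁ (≤-trans near-v 11≤k)
        _ , proper₃ = recolour {G = G} proper₂ (≤-trans near-x 11≤k)
    in _ , λ a b a≢b ab → proper₃ a b a≢b ab (λ ()) (λ ())
    where
    proper₀ : TwoDistColoringExcept G k S₀ (insertAt col x (fromℕ< (≤-trans (s≤s z≤n) 11≤k)))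
    proper₀ = insertAt-TwoDistColoringExcept {G = G} {x = x} proper-∖ (there (there (here refl))) unique-via-x _

proposition2p10 : ∀ {n} (G : Graph n) → MinimalCounterexample G → 7 ≤ maxDeg G →
    ∀ (v u : Fin n) → SpecialII G v → Adj G v u → IsKD G 5 4 u →
    ∀ (w : Fin n) → WeakAdj G u w → 5 < deg G w
proposition2p10 {suc m} G (class , uncolourable , minimal) 7≤Δ v u (v-4-3 , _) vu u-5-4 w (u≢w , x , ux , xw , deg-x)
  with 5 <? deg G w
-- The neighbour of degree 4 or 5 provided by SpecialII is not needed: u plays its role.
... | yes 5<deg-w = 5<deg-w
... | no  5≮deg-w = contradiction
  (Configuration.colourable G v-4-3 u-5-4 vu ux xw deg-x u≢w (≮⇒≥ 5≮deg-w) (+-monoˡ-≤ 4 7≤Δ)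
    (TwoDistColoring-injective-∘ {G = G ∖ x} (λ {i} {j} → inject≤-injective ΔH+4≤Δ+4 ΔH+4≤Δ+4 i j) (proj₂ H-colouring)))
  uncolourable
  where
  H-colouring : TwoDistColorable (G ∖ x) (maxDeg (G ∖ x) + 4)
  H-colouring = minimal m ≤-refl (G ∖ x) (InClass-∖ G x class 7≤Δ (≤-trans (≤-reflexive deg-x) (s≤s (s≤s z≤n))))
  ΔH+4≤Δ+4 : maxDeg (G ∖ x) + 4 ≤ maxDeg G + 4
  ΔH+4≤Δ+4 = +-monoˡ-≤ 4 (maxDeg-∖ G x)
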